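{- For every $m\geq 5$, $\operatorname{im}(C_m\times P_4)=5$.
   Context: All graphs are finite and simple. $C_m$ is the cycle on $m$ vertices and $P_4$ the path on 4 vertices. A graph $G$ has a $G'$-immersion if there is an injective map $\phi:V(G')\to V(G)$ such that for every edge $uv\in E(G')$ there is a path in $G$ joining $\phi(u)$ and $\phi(v)$, and these paths are pairwise edge-disjoint. The immersion number $\operatorname{im}(G)$ is the largest $t$ such that $G$ has a $K_t$-immersion. The direct product $G\times H$ has vertex set $V(G)\times V(H)$, with $(g,h)$ adjacent to $(g',h')$ iff $gg'\in E(G)$ and $hh'\in E(H)$. -}

module Defs where

open import Data.Nat using (ℕ; suc; _+_; _%_; _≤_)
open import Data.Nat.DivMod using ()
open import Data.Fin using (Fin; toℕ)
open import Data.Product using (_×_; Σ; ∃)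
open import Data.Sum using (_⊎_)
open import Data.List using (List; []; _∷_)
open import Data.List.Relation.Unary.Unique.Propositional using (Unique)
open import Relation.Binary.PropositionalEquality using (_≡_; _≢_)
open import Relation.Nullary using (¬_)
open import Function.Definitions using (Injective)

-- A graph: a vertex type with an adjacency relation.  All concrete graphs
-- below are finite, simple (symmetric, irreflexive adjacency).
record Graph : Set₁ where
  field
    V   : Set
    Adj : V → V → Set
open Graph public

K : ℕ → Graph
K t = record { V = Fin t ; Adj = λ i j → i ≢ j }

C : (m : ℕ) → Graph
C 0 = record { V = Fin 0 ; Adj = λ _ _ → Fin 0 }
C (suc n) = record
  { V = Fin (suc n)
  ; Adj = λ i j → (toℕ j ≡ (toℕ i + 1) % suc n) ⊎ (toℕ i ≡ (toℕ j + 1) % suc n) }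

P4 : Graph
P4 = record { V = Fin 4 ; Adj = λ i j → (toℕ j ≡ suc (toℕ i)) ⊎ (toℕ i ≡ suc (toℕ j)) }

_×ᴳ_ : Graph → Graph → Graph
G ×ᴳ H = record
  { V = V G × V H
  ; Adj = λ p q → Adj G (Data.Product.proj₁ p) (Data.Product.proj₁ q)
                × Adj H (Data.Product.proj₂ p) (Data.Product.proj₂ q) }

data Walk (G : Graph) : V G → V G → Set where
  nil  : (x : V G) → Walk G x x
  cons : {x y z : V G} → Adj G x y → Walk G y z → Walk G x z

vertices : {G : Graph} {x y : V G} → Walk G x y → List (V G)
vertices (nil x) = x ∷ []
vertices {x = x} (cons _ w) = x ∷ vertices w

IsPath : {G : Graph} {x y : V G} → Walk G x y → Set
IsPath w = Unique (vertices w)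

data Traverses {G : Graph} : {x y : V G} → Walk G x y → V G → V G → Set where
  here  : {x y z : V G} (e : Adj G x y) (w : Walk G y z) → Traverses (cons e w) x y
  there : {x y z a b : V G} (e : Adj G x y) {w : Walk G y z} →
          Traverses w a b → Traverses (cons e w) a b

UsesEdge : {G : Graph} {x y : V G} → Walk G x y → V G → V G → Set
UsesEdge w a b = Traverses w a b ⊎ Traverses w b a

SameEdge : {A : Set} → A → A → A → A → Set
SameEdge u v u' v' = (u ≡ u' × v ≡ v') ⊎ (u ≡ v' × v ≡ u')

record Immersion (G H : Graph) : Set where
  field
    φ        : V H → V G
    φ-inj    : Injective _≡_ _≡_ φ
    route    : (u v : V H) → Adj H u v → Walk G (φ u) (φ v)
    route-path : (u v : V H) (e : Adj H u v) → IsPath (route u v e)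
    disjoint : (u v u' v' : V H) (e : Adj H u v) (e' : Adj H u' v') →
               ¬ SameEdge u v u' v' →
               (a b : V G) → UsesEdge (route u v e) a b →
               ¬ UsesEdge (route u' v' e') a b

HasImmersion : Graph → Graph → Set
HasImmersion G H = Immersion G H

ImmersionNumberIs : Graph → ℕ → Set
ImmersionNumberIs G t = HasImmersion G (K t) × ((s : ℕ) → HasImmersion G (K s) → s ≤ t)

-- If the neighbours of each vertex of G are told apart by d
-- directions, G has no K_t-immersion with t > d + 1: the t − 1 edge-disjoint
-- routes leaving one branch vertex start along distinct edges (pigeonhole).
-- In C_m × P4 a neighbour is one step forward or back on the cycle and one
-- step up or down on the path, so d = 2 · 2 = 4.
--
-- Write m = s + 2j + 1 with s = 4 (m odd) or s = 5 (m even).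
-- The five branch vertices lie in the columns 0 … s.  Each of the ten routes
-- either stays there, or leaves through column s, zig-zags between two
-- adjacent rows up to the last column and closes the cycle into column 0.
-- Edge-disjointness is certified by labels: an edge within columns 0 … s is
-- its own label, whereas all edges of a zig-zag share one lane label, so a
-- route has a finite label list independent of j.  Routes of distinct pairs
-- have disjoint label lists, which is checked by evaluation, uniformly in j.
module Submission where

open import Defs
import Data.Nat as ℕ
open import Data.Nat using (ℕ; zero; suc; _+_; _*_; _%_; _≤_; _<_; _≤ᵇ_; _<ᵇ_; z≤n; s≤s; s≤s⁻¹)
import Data.Nat.Properties as ℕₚ
open import Data.Nat.DivMod using (m<n⇒m%n≡m; n%n≡0)
open import Data.Fin as Fin using (Fin; toℕ; fromℕ<; #_; combine)
import Data.Fin.Properties as Finₚ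
open import Data.Product using (Σ-syntax; _×_; _,_; proj₁; proj₂)
open import Data.Product.Properties using (≡-dec)
open import Data.Bool using (Bool; true; false; not; _∧_; _xor_)
open import Data.Bool.Properties using (∧-zeroʳ; not-involutive; xor-same; not-distribˡ-xor)
open import Data.Empty using (⊥)
open import Data.Sum using (_⊎_; inj₁; inj₂; swap)
open import Data.List.Relation.Unary.Any using (here; there)
open import Data.List.Relation.Unary.All as All using (All; []; _∷_)
open import Data.List.Relation.Unary.AllPairs as AllPairs using (AllPairs; []; _∷_)
open import Data.List.Membership.Propositional using (_∈_)
open import Data.List.Membership.Propositional.Properties using (∈-++⁺ˡ; ∈-++⁺ʳ)
import Data.List.Relation.Binary.Disjoint.DecPropositional as DecDisjoint
open import Data.List using (List; []; _∷_; _++_; [_]; reverse)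
import Data.List.Properties as Listₚ
open import Data.List.Relation.Unary.Unique.Propositional using (Unique)
import Data.List.Relation.Unary.Unique.DecPropositional as DecUnique
import Data.List.Relation.Unary.Unique.Propositional.Properties as Uniqueₚ
open import Data.List.Relation.Binary.Disjoint.Propositional using (Disjoint)
import Data.List.Relation.Binary.Permutation.Setoid as Perm
import Data.List.Relation.Binary.Permutation.Setoid.Properties as Permₚ
open import Relation.Nullary using (¬_; contradiction; Dec; yes; no; ¬?)
open import Relation.Nullary.Decidable using (True; toWitness; map′; _×-dec_; _⊎-dec_; _→-dec_)
open import Relation.Binary.Definitions using (DecidableEquality; tri<; tri≈; tri>)
open import Function.Definitions using (Injective)
open import Relation.Binary.PropositionalEquality
  using (_≡_; _≢_; refl; sym; trans; cong; cong₂; subst; setoid; module ≡-Reasoning)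

module _ {A : Set} where
  open Perm (setoid A) using (↭-sym)
  open Permₚ (setoid A) using (Unique-resp-↭; ↭-reverse; shifts)

  Unique-reverse : {xs : List A} → Unique xs → Unique (reverse xs)
  Unique-reverse {xs} = Unique-resp-↭ (↭-sym (↭-reverse xs))

  Unique-insert : (xs ys zs : List A) → Unique (xs ++ zs) → Unique ys →
                  Disjoint ys (xs ++ zs) → Unique (xs ++ ys ++ zs)
  Unique-insert xs ys zs xz-unique y-unique disjoint =
    Unique-resp-↭ (shifts ys xs) (Uniqueₚ.++⁺ y-unique xz-unique disjoint)

module _ {G : Graph} where

  infixr 5 _++ʷ_
  _++ʷ_ : {x y z : V G} → Walk G x y → Walk G y z → Walk G x z
  nil _    ++ʷ w′ = w′
  cons e w ++ʷ w′ = cons e (w ++ʷ w′)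

  departures : {x y : V G} → Walk G x y → List (V G)
  departures (nil _)            = []
  departures {x = x} (cons _ w) = x ∷ departures w

  vertices-departures : {x y : V G} (w : Walk G x y) → vertices w ≡ departures w ++ [ y ]
  vertices-departures (nil _)    = refl
  vertices-departures (cons _ w) = cong (_ ∷_) (vertices-departures w)

  vertices-++ʷ : {x y z : V G} (w : Walk G x y) (w′ : Walk G y z) →
                 vertices (w ++ʷ w′) ≡ departures w ++ vertices w′
  vertices-++ʷ (nil _)    w′ = refl
  vertices-++ʷ (cons _ w) w′ = cong (_ ∷_) (vertices-++ʷ w w′)

  traverses-++ʷ : {x y z a b : V G} (w : Walk G x y) (w′ : Walk G y z) →
                  Traverses (w ++ʷ w′) a b → Traverses w a b ⊎ Traverses w′ a b
  traverses-++ʷ (nil _)    w′ t                      = inj₂ t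
  traverses-++ʷ (cons e w) w′ (here .e .(w ++ʷ w′)) = inj₁ (here e w)
  traverses-++ʷ (cons e w) w′ (there .e t) with traverses-++ʷ w w′ t
  ... | inj₁ t′ = inj₁ (there e t′)
  ... | inj₂ t′ = inj₂ t′

module Reversal (G : Graph) (adj-sym : {x y : V G} → Adj G x y → Adj G y x) where

  reverseʷ : {x y : V G} → Walk G x y → Walk G y x
  reverseʷ (nil x)    = nil x
  reverseʷ (cons e w) = reverseʷ w ++ʷ cons (adj-sym e) (nil _)

  traverses-reverseʷ : {x y a b : V G} (w : Walk G x y) → Traverses (reverseʷ w) a b → Traverses w b a
  traverses-reverseʷ (cons e w) t with traverses-++ʷ (reverseʷ w) (cons (adj-sym e) (nil _)) t
  ... | inj₁ t′                        = there e (traverses-reverseʷ w t′)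
  ... | inj₂ (here .(adj-sym e) ._)    = here e w

  vertices-reverseʷ : {x y : V G} (w : Walk G x y) → vertices (reverseʷ w) ≡ reverse (vertices w)
  vertices-reverseʷ (nil x) = refl
  vertices-reverseʷ {x = x} (cons {y = y} e w) = begin
    vertices (reverseʷ w ++ʷ cons (adj-sym e) (nil x)) ≡⟨ vertices-++ʷ (reverseʷ w) _ ⟩
    departures (reverseʷ w) ++ [ y ] ++ [ x ]           ≡⟨ Listₚ.++-assoc (departures (reverseʷ w)) _ _ ⟨
    (departures (reverseʷ w) ++ [ y ]) ++ [ x ]         ≡⟨ cong (_++ [ x ]) (vertices-departures (reverseʷ w)) ⟨
    vertices (reverseʷ w) ++ [ x ]                      ≡⟨ cong (_++ [ x ]) (vertices-reverseʷ w) ⟩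
    reverse (vertices w) ++ [ x ]                       ≡⟨ Listₚ.unfold-reverse x (vertices w) ⟨
    reverse (x ∷ vertices w)                            ∎
    where open ≡-Reasoning

  reverseʷ-isPath : {x y : V G} (w : Walk G x y) → IsPath w → IsPath (reverseʷ w)
  reverseʷ-isPath w w-path = subst Unique (sym (vertices-reverseʷ w)) (Unique-reverse w-path)

record NeighbourCoding (G : Graph) (d : ℕ) : Set where
  field
    direction           : {x y : V G} → Adj G x y → Fin d
    direction-injective : {x y y′ : V G} (e : Adj G x y) (e′ : Adj G x y′) →
                          direction e ≡ direction e′ → y ≡ y′

first-edge : {G : Graph} {x y : V G} → x ≢ y → (w : Walk G x y) →
             Σ[ z ∈ V G ] Adj G x z × Traverses w x z
first-edge x≢y (nil _)    = contradiction refl x≢y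
first-edge _   (cons e w) = _ , e , here e w

-- im(G) ≤ d + 1 for a graph with a neighbour coding in d directions: in a
-- K_t-immersion the t − 1 routes out of the branch vertex φ 0 are edge-disjoint,
-- so their first edges have distinct directions, and pigeonhole gives t − 1 ≤ d.
immersion-bound : {G : Graph} {d t : ℕ} → NeighbourCoding G d → Immersion G (K t) → t ≤ suc d
immersion-bound {t = zero}  _      _  = z≤n
immersion-bound {G} {d} {suc t} coding im = s≤s (ℕₚ.≮⇒≥ collision)
  where
  open NeighbourCoding coding
  open Immersion im

  zero≢suc : (k : Fin t) → Fin.zero ≢ Fin.suc k
  zero≢suc _ ()

  leave : (k : Fin t) → Σ[ z ∈ V G ] Adj G (φ Fin.zero) z × Traverses (route _ _ (zero≢suc k)) (φ Fin.zero) z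
  leave k = first-edge (λ eq → zero≢suc k (φ-inj eq)) (route _ _ (zero≢suc k))

  leaving-direction : Fin t → Fin d
  leaving-direction k = direction (proj₁ (proj₂ (leave k)))

  collision : d < t → ⊥
  collision d<t with Finₚ.pigeonhole d<t leaving-direction
  ... | i , j , i<j , same-direction =
    disjoint Fin.zero (Fin.suc i) Fin.zero (Fin.suc j) (zero≢suc i) (zero≢suc j) different-pairs
             (φ Fin.zero) (proj₁ (leave i)) (inj₁ (proj₂ (proj₂ (leave i))))
             (inj₁ (subst (Traverses _ (φ Fin.zero)) (sym same-neighbour) (proj₂ (proj₂ (leave j)))))
    where
    same-neighbour : proj₁ (leave i) ≡ proj₁ (leave j)
    same-neighbour = direction-injective (proj₁ (proj₂ (leave i))) (proj₁ (proj₂ (leave j))) same-direction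
    different-pairs : ¬ SameEdge Fin.zero (Fin.suc i) Fin.zero (Fin.suc j)
    different-pairs (inj₁ (_ , si≡sj)) = Finₚ.<-irrefl (Finₚ.suc-injective si≡sj) i<j
    different-pairs (inj₂ (() , _))

+1-mod-cases : {n a : ℕ} → a < suc n →
               (a + 1) % suc n ≡ suc a ⊎ (a ≡ n × (a + 1) % suc n ≡ 0)
+1-mod-cases {n} {a} a<m rewrite ℕₚ.+-comm a 1 with ℕₚ.m≤n⇒m<n∨m≡n (s≤s⁻¹ a<m)
... | inj₁ a<n = inj₁ (m<n⇒m%n≡m (s≤s a<n))
... | inj₂ refl = inj₂ (refl , n%n≡0 (suc n))

+1-mod-injective : {n a b : ℕ} → a < suc n → b < suc n → (a + 1) % suc n ≡ (b + 1) % suc n → a ≡ b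
+1-mod-injective a<m b<m = compare (+1-mod-cases a<m) (+1-mod-cases b<m)
  where
  compare : ∀ {n a b} {x y : ℕ} → x ≡ suc a ⊎ (a ≡ n × x ≡ 0) → y ≡ suc b ⊎ (b ≡ n × y ≡ 0) → x ≡ y → a ≡ b
  compare (inj₁ refl)       (inj₁ refl)       eq = ℕₚ.suc-injective eq
  compare (inj₂ (refl , _)) (inj₂ (refl , _)) _  = refl
  compare (inj₁ refl)       (inj₂ (_ , refl)) ()
  compare (inj₂ (_ , refl)) (inj₁ refl)       ()

cycle-coding : (m : ℕ) → NeighbourCoding (C m) 2
cycle-coding zero    = record { direction = λ () ; direction-injective = λ () }
cycle-coding (suc n) = record { direction = direction ; direction-injective = injective }
  where
  direction : {x y : Fin (suc n)} → Adj (C (suc n)) x y → Fin 2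
  direction (inj₁ _) = Fin.zero
  direction (inj₂ _) = Fin.suc Fin.zero

  injective : {x y y′ : Fin (suc n)} (e : Adj (C (suc n)) x y) (e′ : Adj (C (suc n)) x y′) →
              direction e ≡ direction e′ → y ≡ y′
  injective (inj₁ y≡) (inj₁ y′≡) _ = Finₚ.toℕ-injective (trans y≡ (sym y′≡))
  injective {y = y} {y′} (inj₂ x≡) (inj₂ x≡′) _ =
    Finₚ.toℕ-injective (+1-mod-injective (Finₚ.toℕ<n y) (Finₚ.toℕ<n y′) (trans (sym x≡) x≡′))
  injective (inj₁ _) (inj₂ _) ()
  injective (inj₂ _) (inj₁ _) ()

path-coding : NeighbourCoding P4 2
path-coding = record { direction = direction ; direction-injective = injective }
  where
  direction : {x y : Fin 4} → Adj P4 x y → Fin 2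
  direction (inj₁ _) = Fin.zero
  direction (inj₂ _) = Fin.suc Fin.zero

  injective : {x y y′ : Fin 4} (e : Adj P4 x y) (e′ : Adj P4 x y′) → direction e ≡ direction e′ → y ≡ y′
  injective (inj₁ y≡) (inj₁ y′≡) _ = Finₚ.toℕ-injective (trans y≡ (sym y′≡))
  injective (inj₂ x≡) (inj₂ x≡′) _ = Finₚ.toℕ-injective (ℕₚ.suc-injective (trans (sym x≡) x≡′))
  injective (inj₁ _) (inj₂ _) ()
  injective (inj₂ _) (inj₁ _) ()

-- A neighbour in G ×ᴳ H is a pair of neighbours, so directions multiply.
product-coding : {G H : Graph} {a b : ℕ} → NeighbourCoding G a → NeighbourCoding H b →
                 NeighbourCoding (G ×ᴳ H) (a * b)
product-coding {G} {H} {a} {b} cG cH = record { direction = direction ; direction-injective = injective }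
  where
  module CG = NeighbourCoding cG
  module CH = NeighbourCoding cH

  direction : {x y : V (G ×ᴳ H)} → Adj (G ×ᴳ H) x y → Fin (a * b)
  direction (e , f) = combine (CG.direction e) (CH.direction f)

  injective : {x y y′ : V (G ×ᴳ H)} (e : Adj (G ×ᴳ H) x y) (e′ : Adj (G ×ᴳ H) x y′) →
              direction e ≡ direction e′ → y ≡ y′
  injective (e , f) (e′ , f′) eq with Finₚ.combine-injective _ _ _ _ eq
  ... | same-e , same-f = cong₂ _,_ (CG.direction-injective e e′ same-e) (CH.direction-injective f f′ same-f)

cylinder-bound : (m t : ℕ) → Immersion (C m ×ᴳ P4) (K t) → t ≤ 5
cylinder-bound m t = immersion-bound (product-coding (cycle-coding m) path-coding)

SameEdge-sym : {A : Set} {u v u′ v′ : A} → SameEdge u v u′ v′ → SameEdge u′ v′ u v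
SameEdge-sym (inj₁ (refl , refl)) = inj₁ (refl , refl)
SameEdge-sym (inj₂ (refl , refl)) = inj₂ (refl , refl)

SameEdge-trans : {A : Set} {u v u′ v′ u″ v″ : A} → SameEdge u v u′ v′ → SameEdge u′ v′ u″ v″ → SameEdge u v u″ v″
SameEdge-trans (inj₁ (refl , refl)) same           = same
SameEdge-trans (inj₂ (refl , refl)) (inj₁ (refl , refl)) = inj₂ (refl , refl)
SameEdge-trans (inj₂ (refl , refl)) (inj₂ (refl , refl)) = inj₁ (refl , refl)

sameEdge? : {A : Set} → DecidableEquality A → (u v u′ v′ : A) → Dec (SameEdge u v u′ v′)
sameEdge? _≟_ u v u′ v′ = (u ≟ u′ ×-dec v ≟ v′) ⊎-dec (u ≟ v′ ×-dec v ≟ u′)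

injective? : {A : Set} {t : ℕ} → DecidableEquality A → (f : Fin t → A) → Dec (∀ i j → f i ≡ f j → i ≡ j)
injective? _≟_ f = Finₚ.all? λ i → Finₚ.all? λ j → f i ≟ f j →-dec i Finₚ.≟ j

-- The ordered vertex pairs of G are labelled
-- by elements of L; a walk is labelled by a list that contains the labels of
-- all its edges in both directions.  Walks labelled by disjoint lists are edge-disjoint.
module Certificates (G : Graph) (adj-sym : {x y : V G} → Adj G x y → Adj G y x)
                    {L : Set} (label : V G → V G → L) where

  open Reversal G adj-sym

  Labelled : {x y : V G} → List L → Walk G x y → Set
  Labelled ls w = ∀ {a b} → Traverses w a b → label a b ∈ ls × label b a ∈ ls

  labelled-++ : {x y z : V G} {ls ls′ : List L} (w : Walk G x y) (w′ : Walk G y z) →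
                Labelled ls w → Labelled ls′ w′ → Labelled (ls ++ ls′) (w ++ʷ w′)
  labelled-++ {ls = ls} w w′ w-labelled w′-labelled t with traverses-++ʷ w w′ t
  ... | inj₁ t′ = let ab , ba = w-labelled t′  in ∈-++⁺ˡ ab , ∈-++⁺ˡ ba
  ... | inj₂ t′ = let ab , ba = w′-labelled t′ in ∈-++⁺ʳ ls ab , ∈-++⁺ʳ ls ba

  edgeLabels : {x y : V G} → Walk G x y → List L
  edgeLabels (nil _)                      = []
  edgeLabels {x = x} (cons {y = y} _ w) = label x y ∷ label y x ∷ edgeLabels w

  edgeLabels-labelled : {x y : V G} (w : Walk G x y) → Labelled (edgeLabels w) w
  edgeLabels-labelled (cons e w) (here .e .w) = here refl , there (here refl)
  edgeLabels-labelled (cons e w) (there .e t) =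
    let ab , ba = edgeLabels-labelled w t in there (there ab) , there (there ba)

  record LabelledPath (x y : V G) : Set where
    field
      walk     : Walk G x y
      labels   : List L
      isPath   : IsPath walk
      labelled : Labelled labels walk

  open LabelledPath public

  labelled-uses : {x y a b : V G} (P : LabelledPath x y) → UsesEdge (walk P) a b → label a b ∈ labels P
  labelled-uses P (inj₁ t) = proj₁ (labelled P t)
  labelled-uses P (inj₂ t) = proj₂ (labelled P t)

  reverseᴾ : {x y : V G} → LabelledPath x y → LabelledPath y x
  reverseᴾ P = record
    { walk     = reverseʷ (walk P)
    ; labels   = labels P
    ; isPath   = reverseʷ-isPath (walk P) (isPath P)
    ; labelled = λ t → let ba , ab = labelled P (traverses-reverseʷ (walk P) t) in ab , ba }

-- Building a K_t-immersion from labelled paths between the branch vertices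
-- φ i and φ j for i < j: if distinct pairs carry disjoint label lists, the
-- paths (reversed when needed) are pairwise edge-disjoint.
module RouteSystem (G : Graph) (adj-sym : {x y : V G} → Adj G x y → Adj G y x)
                   {L : Set} (label : V G → V G → L) {t : ℕ}
                   (φ : Fin t → V G)
                   (route : {i j : Fin t} → i Fin.< j → Certificates.LabelledPath G adj-sym label (φ i) (φ j)) where

  open Certificates G adj-sym label

  pairLabels : Fin t → Fin t → List L
  pairLabels i j with i Finₚ.<? j
  ... | yes i<j = labels (route i<j)
  ... | no  _   = []

  pairLabels-route : {i j : Fin t} (i<j : i Fin.< j) → labels (route i<j) ≡ pairLabels i j
  pairLabels-route {i} {j} i<j with i Finₚ.<? j
  ... | yes i<j′ = cong (λ p → labels (route p)) (Finₚ.<-irrelevant i<j i<j′)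
  ... | no  i≮j  = contradiction i<j i≮j

  RoutesDisjoint : Set
  RoutesDisjoint = ∀ i j i′ j′ → ¬ SameEdge i j i′ j′ → Disjoint (pairLabels i j) (pairLabels i′ j′)

  routesDisjoint? : DecidableEquality L → Dec RoutesDisjoint
  routesDisjoint? _≟_ =
    Finₚ.all? λ i → Finₚ.all? λ j → Finₚ.all? λ i′ → Finₚ.all? λ j′ →
      ¬? (sameEdge? Finₚ._≟_ i j i′ j′) →-dec DecDisjoint.disjoint? _≟_ (pairLabels i j) (pairLabels i′ j′)

  connect : (u v : Fin t) → u ≢ v → LabelledPath (φ u) (φ v)
  connect u v u≢v with Finₚ.<-cmp u v
  ... | tri< u<v _ _ = route u<v
  ... | tri≈ _ u≡v _ = contradiction u≡v u≢v
  ... | tri> _ _ v<u = reverseᴾ (route v<u)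

  connect-labels : (u v : Fin t) (u≢v : u ≢ v) →
                   Σ[ (i , j) ∈ Fin t × Fin t ] SameEdge u v i j × labels (connect u v u≢v) ≡ pairLabels i j
  connect-labels u v u≢v with Finₚ.<-cmp u v
  ... | tri< u<v _ _ = (u , v) , inj₁ (refl , refl) , pairLabels-route u<v
  ... | tri≈ _ u≡v _ = contradiction u≡v u≢v
  ... | tri> _ _ v<u = (v , u) , inj₂ (refl , refl) , pairLabels-route v<u

  immersion : Injective _≡_ _≡_ φ → RoutesDisjoint → Immersion G (K t)
  immersion φ-inj routes-disjoint = record
    { φ          = φ
    ; φ-inj      = φ-inj
    ; route      = λ u v u≢v → walk (connect u v u≢v)
    ; route-path = λ u v u≢v → isPath (connect u v u≢v)
    ; disjoint   = edge-disjoint }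
    where
    edge-disjoint : (u v u′ v′ : Fin t) (u≢v : u ≢ v) (u′≢v′ : u′ ≢ v′) → ¬ SameEdge u v u′ v′ →
                    (a b : V G) → UsesEdge (walk (connect u v u≢v)) a b → ¬ UsesEdge (walk (connect u′ v′ u′≢v′)) a b
    edge-disjoint u v u′ v′ u≢v u′≢v′ different a b uses uses′
      with connect-labels u v u≢v | connect-labels u′ v′ u′≢v′
    ... | (i , j) , uv~ij , ls≡ | (i′ , j′) , uv′~ij′ , ls′≡ =
      routes-disjoint i j i′ j′
        (λ ij~ij′ → different (SameEdge-trans uv~ij (SameEdge-trans ij~ij′ (SameEdge-sym uv′~ij′))))
        ( subst (label a b ∈_) ls≡  (labelled-uses (connect u v u≢v) uses)
        , subst (label a b ∈_) ls′≡ (labelled-uses (connect u′ v′ u′≢v′) uses′))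

cycle-adj? : (m : ℕ) (x y : V (C m)) → Dec (Adj (C m) x y)
cycle-adj? zero    ()
cycle-adj? (suc n) x y = (toℕ y ℕₚ.≟ (toℕ x + 1) % suc n) ⊎-dec (toℕ x ℕₚ.≟ (toℕ y + 1) % suc n)

path-adj? : (x y : Fin 4) → Dec (Adj P4 x y)
path-adj? x y = (toℕ y ℕₚ.≟ suc (toℕ x)) ⊎-dec (toℕ x ℕₚ.≟ suc (toℕ y))

product-adj? : {G H : Graph} → (∀ x y → Dec (Adj G x y)) → (∀ x y → Dec (Adj H x y)) →
               ∀ x y → Dec (Adj (G ×ᴳ H) x y)
product-adj? G-adj? H-adj? (x , x′) (y , y′) = G-adj? x y ×-dec H-adj? x′ y′

cylinder-adj-sym : {m : ℕ} {x y : V (C m ×ᴳ P4)} → Adj (C m ×ᴳ P4) x y → Adj (C m ×ᴳ P4) y x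
cylinder-adj-sym {suc n} (e , f) = swap e , swap f

cycle-step : {n c : ℕ} (c<m : c < suc n) (c+1<m : suc c < suc n) → Adj (C (suc n)) (fromℕ< c<m) (fromℕ< c+1<m)
cycle-step {n} {c} c<m c+1<m = inj₁ (begin
  toℕ (fromℕ< c+1<m)             ≡⟨ Finₚ.toℕ-fromℕ< c+1<m ⟩
  suc c                          ≡⟨ m<n⇒m%n≡m c+1<m ⟨
  suc c % suc n                  ≡⟨ cong (_% suc n) (ℕₚ.+-comm 1 c) ⟩
  (c + 1) % suc n                ≡⟨ cong (λ a → (a + 1) % suc n) (Finₚ.toℕ-fromℕ< c<m) ⟨
  (toℕ (fromℕ< c<m) + 1) % suc n ∎)
  where open ≡-Reasoning

cycle-closing : {n c : ℕ} (c<m : c < suc n) → c ≡ n → Adj (C (suc n)) (fromℕ< c<m) Fin.zero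
cycle-closing {n} c<m refl = inj₁ (sym (begin
  (toℕ (fromℕ< c<m) + 1) % suc n ≡⟨ cong (λ a → (a + 1) % suc n) (Finₚ.toℕ-fromℕ< c<m) ⟩
  (n + 1) % suc n                ≡⟨ cong (_% suc n) (ℕₚ.+-comm n 1) ⟩
  suc n % suc n                  ≡⟨ n%n≡0 (suc n) ⟩
  0                              ∎))
  where open ≡-Reasoning

module WalkNotation (G : Graph) (adj? : ∀ x y → Dec (Adj G x y)) where
  infixr 5 _⇒_
  _⇒_ : (x : V G) {y z : V G} {x~y : True (adj? x y)} → Walk G y z → Walk G x z
  _⇒_ x {x~y = x~y} w = cons (toWitness x~y) w

parity : ℕ → Bool
parity zero    = false
parity (suc c) = not (parity c)

<ᵇ-false : {m n : ℕ} → n ≤ m → (m <ᵇ n) ≡ false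
<ᵇ-false {m}     {zero}  _       = refl
<ᵇ-false {suc m} {suc n} (s≤s p) = <ᵇ-false p

-- The cylinder C_m × P4 with m = s + 2j + 1: the columns 0 … s hold the
-- branch vertices, the remaining 2j columns are crossed by zig-zags.
module Cylinder (s j : ℕ) (2≤s : 2 ≤ s) where

  n : ℕ
  n = s + j * 2

  G : Graph
  G = C (suc n) ×ᴳ P4

  col : V G → ℕ
  col u = toℕ (proj₁ u)

  row : V G → Fin 4
  row = proj₂

  _≟ⱽ_ : DecidableEquality (V G)
  _≟ⱽ_ = ≡-dec Finₚ._≟_ Finₚ._≟_

  ⟨_,_⟩ : (c r : ℕ) {c<m : True (suc c ℕ.≤? suc n)} {r<4 : True (suc r ℕ.≤? 4)} → V G
  ⟨_,_⟩ c r {c<m} {r<4} = (# c) {m<n = c<m} , (# r) {m<n = r<4}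

  open WalkNotation G (product-adj? (cycle-adj? (suc n)) path-adj?) public

  -- Inside the columns 0 … s an edge is its
  -- own label; the edge from column n back to column 0 is labelled by its two
  -- rows; further right, edges are labelled by their lane: the row at the
  -- endpoint whose column has the parity of s, and the row at the other one.
  data EdgeLabel : Set where
    inner   : V G → V G → EdgeLabel
    closing : Fin 4 → Fin 4 → EdgeLabel
    lane    : Fin 4 → Fin 4 → EdgeLabel

  _≟ᴸ_ : DecidableEquality EdgeLabel
  inner u v   ≟ᴸ inner u′ v′   = map′ (λ (p , q) → cong₂ inner p q) (λ { refl → refl , refl }) (u ≟ⱽ u′ ×-dec v ≟ⱽ v′)
  closing r q ≟ᴸ closing r′ q′ = map′ (λ (p , p′) → cong₂ closing p p′) (λ { refl → refl , refl }) (r Finₚ.≟ r′ ×-dec q Finₚ.≟ q′)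
  lane r q    ≟ᴸ lane r′ q′    = map′ (λ (p , p′) → cong₂ lane p p′) (λ { refl → refl , refl }) (r Finₚ.≟ r′ ×-dec q Finₚ.≟ q′)
  inner _ _   ≟ᴸ closing _ _ = no λ ()
  inner _ _   ≟ᴸ lane _ _    = no λ ()
  closing _ _ ≟ᴸ inner _ _   = no λ ()
  closing _ _ ≟ᴸ lane _ _    = no λ ()
  lane _ _    ≟ᴸ inner _ _   = no λ ()
  lane _ _    ≟ᴸ closing _ _ = no λ ()

  -- lane of an edge whose left endpoint has the parity of s (false) or not (true)
  laneLabel : Bool → Fin 4 → Fin 4 → EdgeLabel
  laneLabel false r r′ = lane r r′
  laneLabel true  r r′ = lane r′ r

  innerOrLane : Bool → ℕ → V G → V G → EdgeLabel
  innerOrLane true  _ u v = inner u v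
  innerOrLane false c u v = laneLabel (parity c xor parity s) (row u) (row v)

  labelAt : ℕ → ℕ → V G → V G → EdgeLabel
  labelAt zero          (suc (suc _)) u v = closing (row v) (row u)
  labelAt (suc (suc _)) zero          u v = closing (row u) (row v)
  labelAt c             c′            u v = innerOrLane ((c ≤ᵇ s) ∧ (c′ ≤ᵇ s)) c u v

  label : V G → V G → EdgeLabel
  label u v = labelAt (col u) (col v) u v

  adj-sym : {x y : V G} → Adj G x y → Adj G y x
  adj-sym = cylinder-adj-sym {suc n}

  open Certificates G adj-sym label public
  open DecUnique _≟ⱽ_ using (unique?)

  localPath : {x y : V G} (w : Walk G x y) {w-path : True (unique? (vertices w))} → LabelledPath x y
  localPath w {w-path} = record
    { walk = w ; labels = edgeLabels w ; isPath = toWitness w-path ; labelled = edgeLabels-labelled w }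

  -- Reading an edge backwards flips the parity of its left endpoint.
  laneLabel-not : (b : Bool) (r r′ : Fin 4) → laneLabel (not b) r′ r ≡ laneLabel b r r′
  laneLabel-not false _ _ = refl
  laneLabel-not true  _ _ = refl

  lane-edge : (c : ℕ) (u v : V G) → col u ≡ c → col v ≡ suc c → s ≤ c →
              label u v ≡ laneLabel (parity c xor parity s) (row u) (row v) ×
              label v u ≡ laneLabel (parity c xor parity s) (row u) (row v)
  lane-edge zero          _ _ _ _ s≤c = contradiction (ℕₚ.≤-trans 2≤s s≤c) λ ()
  lane-edge (suc zero)    _ _ _ _ s≤c = contradiction (ℕₚ.≤-trans 2≤s s≤c) λ { (s≤s ()) }
  lane-edge c@(suc (suc _)) u v cu cv s≤c rewrite cu | cv =
      cong (λ b → innerOrLane b c u v) (trans (cong ((c ≤ᵇ s) ∧_) (<ᵇ-false s≤c)) (∧-zeroʳ _))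
    , trans (cong (λ b → innerOrLane (b ∧ (c ≤ᵇ s)) (suc c) v u) (<ᵇ-false s≤c))
            (trans (cong (λ b → laneLabel b (row v) (row u)) (sym (not-distribˡ-xor (parity c) (parity s))))
                   (laneLabel-not (parity c xor parity s) (row u) (row v)))

  closing-edge : (c : ℕ) (u v : V G) → col u ≡ c → col v ≡ 0 → 2 ≤ c →
                 label u v ≡ closing (row u) (row v) × label v u ≡ closing (row u) (row v)
  closing-edge (suc (suc _)) u v cu cv _ rewrite cu | cv = refl , refl
  closing-edge (suc zero)    _ _ _  _  (s≤s ())

  Increasing : List (V G) → Set
  Increasing = AllPairs (λ u v → col u < col v)

  increasing-∷ : {u v : V G} {vs : List (V G)} → col u < col v → Increasing (v ∷ vs) → Increasing (u ∷ v ∷ vs)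
  increasing-∷ u<v increasing@(v< ∷ _) = (u<v ∷ All.map (ℕₚ.<-trans u<v) v<) ∷ increasing

  increasing-unique : {vs : List (V G)} → Increasing vs → Unique vs
  increasing-unique = AllPairs.map λ u<v u≡v → ℕₚ.<-irrefl (cong col u≡v) u<v

  at : {c : ℕ} → c < suc n → Fin 4 → V G
  at c<m r = fromℕ< c<m , r

  col-at : {c : ℕ} (c<m : c < suc n) (r : Fin 4) → col (at c<m r) ≡ c
  col-at c<m _ = Finₚ.toℕ-fromℕ< c<m

  next-column : {c : ℕ} (c<m : c < suc n) (c+1<m : suc c < suc n) (r r′ : Fin 4) → col (at c<m r) < col (at c+1<m r′)
  next-column c<m c+1<m r r′ = ℕₚ.≤-reflexive (trans (cong suc (col-at c<m r)) (sym (col-at c+1<m r′)))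

  -- Columns c with c + 2k = n, from which a zig-zag can run to the end of the cycle.
  column-bound : (c k : ℕ) → c + k * 2 ≡ n → c < suc n
  column-bound c k eq = s≤s (subst (c ≤_) eq (ℕₚ.m≤m+n c (k * 2)))

  two-right : (c k : ℕ) → c + suc k * 2 ≡ n → suc (suc c) + k * 2 ≡ n
  two-right c k eq = trans (cong suc (sym (ℕₚ.+-suc c (k * 2)))) (trans (sym (ℕₚ.+-suc c (suc (k * 2)))) eq)

  module Zigzag {r₀ r₁ : Fin 4} (r₀~r₁ : Adj P4 r₀ r₁) where

    zigzag : (k c : ℕ) (eq : c + k * 2 ≡ n) → Walk G (at (column-bound c k eq) r₀) (Fin.zero , r₁)
    zigzag zero    c eq = cons (cycle-closing (column-bound c 0 eq) (trans (sym (ℕₚ.+-identityʳ c)) eq) , r₀~r₁) (nil _)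
    zigzag (suc k) c eq =
      cons (cycle-step c<m c+1<m , r₀~r₁) (cons (cycle-step c+1<m c+2<m , swap r₀~r₁) (zigzag k (suc (suc c)) (two-right c k eq)))
      where
      c<m   = column-bound c (suc k) eq
      c+2<m = column-bound (suc (suc c)) k (two-right c k eq)
      c+1<m = ℕₚ.<⇒≤ c+2<m

    first-step-lane : {c : ℕ} → parity c ≡ parity s → laneLabel (parity c xor parity s) r₀ r₁ ≡ lane r₀ r₁
    first-step-lane same rewrite same = cong (λ b → laneLabel b r₀ r₁) (xor-same (parity s))

    second-step-lane : {c : ℕ} → parity c ≡ parity s → laneLabel (parity (suc c) xor parity s) r₁ r₀ ≡ lane r₀ r₁
    second-step-lane same rewrite same =
      cong (λ b → laneLabel b r₁ r₀) (trans (sym (not-distribˡ-xor (parity s) (parity s))) (cong not (xor-same (parity s))))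

    zigzag-labelled : (k c : ℕ) (eq : c + k * 2 ≡ n) → s ≤ c → parity c ≡ parity s →
                      Labelled (lane r₀ r₁ ∷ closing r₀ r₁ ∷ []) (zigzag k c eq)
    zigzag-labelled zero c eq s≤c _ (here _ _) =
      let ab , ba = closing-edge c (at c<m r₀) (Fin.zero , r₁) (col-at c<m r₀) refl (ℕₚ.≤-trans 2≤s s≤c)
      in there (here ab) , there (here ba)
      where c<m = column-bound c 0 eq
    zigzag-labelled (suc k) c eq s≤c same (here _ _) =
      let ab , ba = lane-edge c (at c<m r₀) (at c+1<m r₁) (col-at c<m r₀) (col-at c+1<m r₁) s≤c
      in here (trans ab (first-step-lane {c} same)) , here (trans ba (first-step-lane {c} same))
      where
      c<m   = column-bound c (suc k) eq
      c+1<m = ℕₚ.<⇒≤ (column-bound (suc (suc c)) k (two-right c k eq))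
    zigzag-labelled (suc k) c eq s≤c same (there _ (here _ _)) =
      let ab , ba = lane-edge (suc c) (at c+1<m r₁) (at c+2<m r₀) (col-at c+1<m r₁) (col-at c+2<m r₀) (ℕₚ.m≤n⇒m≤1+n s≤c)
      in here (trans ab (second-step-lane {c} same)) , here (trans ba (second-step-lane {c} same))
      where
      c+2<m = column-bound (suc (suc c)) k (two-right c k eq)
      c+1<m = ℕₚ.<⇒≤ c+2<m
    zigzag-labelled (suc k) c eq s≤c same (there _ (there _ t)) =
      zigzag-labelled k (suc (suc c)) (two-right c k eq) (ℕₚ.m≤n⇒m≤1+n (ℕₚ.m≤n⇒m≤1+n s≤c))
                      (trans (not-involutive (parity c)) same) t

    zigzag-departures : (k c : ℕ) (eq : c + k * 2 ≡ n) →
                        Σ[ rest ∈ List (V G) ] departures (zigzag k c eq) ≡ at (column-bound c k eq) r₀ ∷ rest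
                                              × Increasing (at (column-bound c k eq) r₀ ∷ rest)
    zigzag-departures zero    c eq = [] , refl , [] ∷ []
    zigzag-departures (suc k) c eq =
      let rest , departures≡ , increasing = zigzag-departures k (suc (suc c)) (two-right c k eq)
      in  at c+1<m r₁ ∷ at c+2<m r₀ ∷ rest
        , cong (λ vs → at c<m r₀ ∷ at c+1<m r₁ ∷ vs) departures≡
        , increasing-∷ (next-column c<m c+1<m r₀ r₁) (increasing-∷ (next-column c+1<m c+2<m r₁ r₀) increasing)
      where
      c<m   = column-bound c (suc k) eq
      c+2<m = column-bound (suc (suc c)) k (two-right c k eq)
      c+1<m = ℕₚ.<⇒≤ c+2<m

    zigzag-route-isPath : {x y : V G} (L₁ : Walk G x (at (column-bound s j refl) r₀)) (L₂ : Walk G (Fin.zero , r₁) y) →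
                          Unique (vertices L₁ ++ vertices L₂) → All (λ v → col v ≤ s) (vertices L₁ ++ vertices L₂) →
                          IsPath (L₁ ++ʷ zigzag j s refl ++ʷ L₂)
    zigzag-route-isPath L₁ L₂ L-unique L-left =
      subst Unique (sym vertices≡)
        (Unique-insert (vertices L₁) rest (vertices L₂) L-unique (increasing-unique rest-increasing) rest-beyond)
      where
      s<m = column-bound s j refl
      Z = zigzag j s refl
      shape = zigzag-departures j s refl
      rest = proj₁ shape

      rest-increasing : Increasing rest
      rest-increasing with _ ∷ increasing ← proj₂ (proj₂ shape) = increasing

      rest-beyond : Disjoint rest (vertices L₁ ++ vertices L₂)
      rest-beyond {v} (v∈rest , v∈L) with s<col ∷ _ ← proj₂ (proj₂ shape) =
        ℕₚ.<⇒≱ (subst (_< col v) (col-at s<m r₀) (All.lookup s<col v∈rest)) (All.lookup L-left v∈L)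

      vertices≡ : vertices (L₁ ++ʷ Z ++ʷ L₂) ≡ vertices L₁ ++ rest ++ vertices L₂
      vertices≡ = begin
        vertices (L₁ ++ʷ Z ++ʷ L₂)                            ≡⟨ vertices-++ʷ L₁ _ ⟩
        departures L₁ ++ vertices (Z ++ʷ L₂)                  ≡⟨ cong (departures L₁ ++_) (vertices-++ʷ Z L₂) ⟩
        departures L₁ ++ departures Z ++ vertices L₂          ≡⟨ cong (λ vs → departures L₁ ++ vs ++ vertices L₂) (proj₁ (proj₂ shape)) ⟩
        departures L₁ ++ [ at s<m r₀ ] ++ rest ++ vertices L₂ ≡⟨ Listₚ.++-assoc (departures L₁) _ _ ⟨
        (departures L₁ ++ [ at s<m r₀ ]) ++ rest ++ vertices L₂ ≡⟨ cong (_++ rest ++ vertices L₂) (vertices-departures L₁) ⟨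
        vertices L₁ ++ rest ++ vertices L₂                    ∎
        where open ≡-Reasoning

    zigzagRoute : {x y : V G} (L₁ : Walk G x (at (column-bound s j refl) r₀)) (L₂ : Walk G (Fin.zero , r₁) y) →
                  Unique (vertices L₁ ++ vertices L₂) → All (λ v → col v ≤ s) (vertices L₁ ++ vertices L₂) →
                  LabelledPath x y
    zigzagRoute L₁ L₂ L-unique L-left = record
      { walk     = L₁ ++ʷ zigzag j s refl ++ʷ L₂
      ; labels   = edgeLabels L₁ ++ lane r₀ r₁ ∷ closing r₀ r₁ ∷ edgeLabels L₂
      ; isPath   = zigzag-route-isPath L₁ L₂ L-unique L-left
      ; labelled = labelled-++ L₁ _ (edgeLabels-labelled L₁)
                     (labelled-++ (zigzag j s refl) L₂ (zigzag-labelled j s refl ℕₚ.≤-refl refl) (edgeLabels-labelled L₂)) }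

  zigzagPath : {x y : V G} {r₀ r₁ : Fin 4} (L₁ : Walk G x (at (column-bound s j refl) r₀)) (L₂ : Walk G (Fin.zero , r₁) y)
               {r₀~r₁ : True (path-adj? r₀ r₁)}
               {L-unique : True (unique? (vertices L₁ ++ vertices L₂))}
               {L-left : True (All.all? (λ v → col v ℕ.≤? s) (vertices L₁ ++ vertices L₂))} → LabelledPath x y
  zigzagPath L₁ L₂ {r₀~r₁} {L-unique} {L-left} =
    Zigzag.zigzagRoute (toWitness r₀~r₁) L₁ L₂ (toWitness L-unique) (toWitness L-left)

  immersionFromRoutes : {t : ℕ} (φ : Fin t → V G) (route : {i i′ : Fin t} → i Fin.< i′ → LabelledPath (φ i) (φ i′))
                        {φ-injective : True (injective? _≟ⱽ_ φ)}
                        {disjoint : True (RouteSystem.routesDisjoint? G adj-sym label φ route _≟ᴸ_)} → Immersion G (K t)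
  immersionFromRoutes φ route {φ-injective} {disjoint} =
    immersion (λ {i} {i′} → toWitness φ-injective i i′) (toWitness disjoint)
    where open RouteSystem G adj-sym label φ route

pattern 𝟎 = Fin.zero
pattern 𝟏 = Fin.suc 𝟎
pattern 𝟐 = Fin.suc 𝟏
pattern 𝟑 = Fin.suc 𝟐
pattern 𝟒 = Fin.suc 𝟑

module OddCycle (j : ℕ) where
  open Cylinder 4 j (s≤s (s≤s z≤n))

  φ : Fin 5 → V G
  φ 𝟎 = ⟨ 0 , 1 ⟩
  φ 𝟏 = ⟨ 0 , 2 ⟩
  φ 𝟐 = ⟨ 1 , 1 ⟩
  φ 𝟑 = ⟨ 1 , 2 ⟩
  φ 𝟒 = ⟨ 2 , 1 ⟩

  route : {i i′ : Fin 5} → i Fin.< i′ → LabelledPath (φ i) (φ i′)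
  route {𝟎} {𝟏} _ = reverseᴾ (zigzagPath (⟨ 0 , 2 ⟩ ⇒ ⟨ 1 , 3 ⟩ ⇒ ⟨ 2 , 2 ⟩ ⇒ ⟨ 3 , 1 ⟩ ⇒ nil ⟨ 4 , 0 ⟩) (nil ⟨ 0 , 1 ⟩))
  route {𝟎} {𝟐} _ = reverseᴾ (zigzagPath (⟨ 1 , 1 ⟩ ⇒ ⟨ 2 , 0 ⟩ ⇒ ⟨ 3 , 1 ⟩ ⇒ nil ⟨ 4 , 2 ⟩) (nil ⟨ 0 , 1 ⟩))
  route {𝟎} {𝟑} _ = localPath (⟨ 0 , 1 ⟩ ⇒ nil ⟨ 1 , 2 ⟩)
  route {𝟎} {𝟒} _ = localPath (⟨ 0 , 1 ⟩ ⇒ ⟨ 1 , 0 ⟩ ⇒ nil ⟨ 2 , 1 ⟩)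
  route {𝟏} {𝟐} _ = localPath (⟨ 0 , 2 ⟩ ⇒ nil ⟨ 1 , 1 ⟩)
  route {𝟏} {𝟑} _ = reverseᴾ (zigzagPath (⟨ 1 , 2 ⟩ ⇒ ⟨ 2 , 3 ⟩ ⇒ ⟨ 3 , 2 ⟩ ⇒ nil ⟨ 4 , 1 ⟩) (nil ⟨ 0 , 2 ⟩))
  route {𝟏} {𝟒} _ = reverseᴾ (zigzagPath (⟨ 2 , 1 ⟩ ⇒ ⟨ 3 , 2 ⟩ ⇒ nil ⟨ 4 , 3 ⟩) (nil ⟨ 0 , 2 ⟩))
  route {𝟐} {𝟑} _ = zigzagPath (⟨ 1 , 1 ⟩ ⇒ ⟨ 2 , 2 ⟩ ⇒ ⟨ 3 , 3 ⟩ ⇒ nil ⟨ 4 , 2 ⟩) (⟨ 0 , 3 ⟩ ⇒ nil ⟨ 1 , 2 ⟩)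
  route {𝟐} {𝟒} _ = reverseᴾ (zigzagPath (⟨ 2 , 1 ⟩ ⇒ ⟨ 3 , 0 ⟩ ⇒ nil ⟨ 4 , 1 ⟩) (⟨ 0 , 0 ⟩ ⇒ nil ⟨ 1 , 1 ⟩))
  route {𝟑} {𝟒} _ = localPath (⟨ 1 , 2 ⟩ ⇒ nil ⟨ 2 , 1 ⟩)
  route {_}           {𝟎} ()
  route {Fin.suc _}   {𝟏} (s≤s ())
  route {Fin.suc (Fin.suc _)} {𝟐} (s≤s (s≤s ()))
  route {Fin.suc (Fin.suc (Fin.suc _))} {𝟑} (s≤s (s≤s (s≤s ())))
  route {Fin.suc (Fin.suc (Fin.suc (Fin.suc _)))} {𝟒} (s≤s (s≤s (s≤s (s≤s ()))))

  K₅-immersion : Immersion G (K 5)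
  K₅-immersion = immersionFromRoutes φ route

module EvenCycle (j : ℕ) where
  open Cylinder 5 j (s≤s (s≤s z≤n))

  φ : Fin 5 → V G
  φ 𝟎 = ⟨ 0 , 1 ⟩
  φ 𝟏 = ⟨ 1 , 2 ⟩
  φ 𝟐 = ⟨ 2 , 1 ⟩
  φ 𝟑 = ⟨ 3 , 2 ⟩
  φ 𝟒 = ⟨ 4 , 1 ⟩

  route : {i i′ : Fin 5} → i Fin.< i′ → LabelledPath (φ i) (φ i′)
  route {𝟎} {𝟏} _ = localPath (⟨ 0 , 1 ⟩ ⇒ nil ⟨ 1 , 2 ⟩)
  route {𝟎} {𝟐} _ = localPath (⟨ 0 , 1 ⟩ ⇒ ⟨ 1 , 0 ⟩ ⇒ nil ⟨ 2 , 1 ⟩)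
  route {𝟎} {𝟑} _ = reverseᴾ (zigzagPath (⟨ 3 , 2 ⟩ ⇒ ⟨ 4 , 3 ⟩ ⇒ nil ⟨ 5 , 2 ⟩) (nil ⟨ 0 , 1 ⟩))
  route {𝟎} {𝟒} _ = reverseᴾ (zigzagPath (⟨ 4 , 1 ⟩ ⇒ nil ⟨ 5 , 0 ⟩) (nil ⟨ 0 , 1 ⟩))
  route {𝟏} {𝟐} _ = localPath (⟨ 1 , 2 ⟩ ⇒ nil ⟨ 2 , 1 ⟩)
  route {𝟏} {𝟑} _ = localPath (⟨ 1 , 2 ⟩ ⇒ ⟨ 2 , 3 ⟩ ⇒ nil ⟨ 3 , 2 ⟩)
  route {𝟏} {𝟒} _ = reverseᴾ (zigzagPath (⟨ 4 , 1 ⟩ ⇒ nil ⟨ 5 , 2 ⟩) (⟨ 0 , 3 ⟩ ⇒ nil ⟨ 1 , 2 ⟩))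
  route {𝟐} {𝟑} _ = localPath (⟨ 2 , 1 ⟩ ⇒ nil ⟨ 3 , 2 ⟩)
  route {𝟐} {𝟒} _ = localPath (⟨ 2 , 1 ⟩ ⇒ ⟨ 3 , 0 ⟩ ⇒ nil ⟨ 4 , 1 ⟩)
  route {𝟑} {𝟒} _ = localPath (⟨ 3 , 2 ⟩ ⇒ nil ⟨ 4 , 1 ⟩)
  route {_}           {𝟎} ()
  route {Fin.suc _}   {𝟏} (s≤s ())
  route {Fin.suc (Fin.suc _)} {𝟐} (s≤s (s≤s ()))
  route {Fin.suc (Fin.suc (Fin.suc _))} {𝟑} (s≤s (s≤s (s≤s ())))
  route {Fin.suc (Fin.suc (Fin.suc (Fin.suc _)))} {𝟒} (s≤s (s≤s (s≤s (s≤s ()))))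

  K₅-immersion : Immersion G (K 5)
  K₅-immersion = immersionFromRoutes φ route

even-or-odd : (d : ℕ) → Σ[ j ∈ ℕ ] (d ≡ j * 2 ⊎ d ≡ suc (j * 2))
even-or-odd zero = 0 , inj₁ refl
even-or-odd (suc zero) = 0 , inj₂ refl
even-or-odd (suc (suc d)) with even-or-odd d
... | j , inj₁ refl = suc j , inj₁ refl
... | j , inj₂ refl = suc j , inj₂ refl

cylinder-K₅ : (d : ℕ) → Immersion (C (5 + d) ×ᴳ P4) (K 5)
cylinder-K₅ d with even-or-odd d
... | j , inj₁ refl = OddCycle.K₅-immersion j
... | j , inj₂ refl = EvenCycle.K₅-immersion j

theorem27 : (m : ℕ) → 5 ≤ m → ImmersionNumberIs (C m ×ᴳ P4) 5
theorem27 m 5≤m with ℕₚ.m≤n⇒∃[o]m+o≡n 5≤m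
... | d , refl = cylinder-K₅ d , cylinder-bound (5 + d)
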